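{- Let $\mathcal{F}=\langle T,\sqsubset,\mathbf{Choice},\{\sim_\alpha\}_{\alpha\in Ags}\rangle$ be any epistemic branching discrete-time frame, let $\phi$ be any formula of $\mathcal{L}_{\textsf{KX}}$ and let $\alpha\in Ags$. Then the following two formulas are valid on $\mathcal{F}$ (i.e. true at every situation $\langle m,h\rangle$ of every model based on $\mathcal{F}$): $$\Box K_\alpha \Box X\phi \to K_\alpha[\alpha]X\phi \qquad\text{and}\qquad K_\alpha[\alpha]X\phi \to X K_\alpha Y[Ags]X\phi .$$
   Context: Let $Ags$ be a finite set of agents and $P$ a countable set of propositional letters. The language $\mathcal{L}_{\textsf{KX}}$ is given by $\phi ::= p \mid \neg\phi \mid \phi\wedge\phi \mid \Box\phi \mid X\phi \mid Y\phi \mid [\alpha]\phi \mid [Ags]\phi \mid K_\alpha\phi$ ($p\in P$, $\alpha\in Ags$); $\Diamond=\neg\Box\neg$. An epistemic branching discrete-time (BDT) frame is a tuple $\langle T,\sqsubset,\mathbf{Choice},\{\sim_\alpha\}_{\alpha\in Ags}\rangle$ where: $T$ is a nonempty set of moments and $\sqsubset$ is a strict partial order on $T$ with no backward branching; a history is a maximal $\sqsubset$-chain, $H$ is the set of histories, $H_m=\{h\in H: m\in h\}$, and a situation is a pair $\langle m,h\rangle$ with $m\in h$. For every $m$ and $h\in H_m$ there is a unique $m^{+h}\in h$ with $m\sqsubset m^{+h}$ and $m^{+h}\sqsubseteq m'$ for all $m'\in h$ with $m\sqsubset m'$, and a unique $m^{ -h}\in h$ with $m^{ -h}\sqsubset m$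 and $m'\sqsubseteq m^{ -h}$ for all $m'\in h$ with $m'\sqsubset m$. $\mathbf{Choice}$ assigns to each $\alpha$ and $m$ a partition $\mathbf{Choice}^m_\alpha$ of $H_m$ (with $\mathbf{Choice}^m_\alpha(h)$ the cell containing $h$), and $\mathbf{Choice}^m_{Ags}(h)=\bigcap_{\alpha}\mathbf{Choice}^m_\alpha(h)$; it satisfies (no choice between undivided histories) if $h,h'\in H_m$ share some moment $m'\sqsupset m$ then they lie in the same cell of every $\mathbf{Choice}^m_\alpha$, and (independence of agency) for every $m$ and every selection of one cell $s(\alpha)\in\mathbf{Choice}^m_\alpha$ per agent, $\bigcap_\alpha s(\alpha)\neq\emptyset$. Each $\sim_\alpha$ is an equivalence relation on situations satisfying (no forgetting): if $\langle m^{+h},h\rangle\sim_\alpha\langle m_*,h_*\rangle$ then $\langle m,h\rangle\sim_\alpha\langle m_*^{ -h_*},h_*\rangle$. A model adds a valuation $\mathcal{V}:P\to 2^{T\times H}$. Truth at situations: $p$ iff $\langle m,h\rangle\in\mathcal{V}(p)$; Booleans as usual; $\Box\phi$ iff $\phi$ holds at $\langle m,h'\rangle$ for all $h'\in H_m$; $X\phi$ iff $\phi$ holds at $\langle m^{+h},h\rangle$; $Y\phi$ iff $\phi$ holds at $\langle m^{ -h},h\rangle$; $[\alpha]\phi$ iff $\phi$ holds at $\langle m,h'\rangle$ for all $h'\in\mathbf{Choice}^m_\alpha(h)$; $[Ags]\phi$ likewise with $\mathbf{Choice}^m_{Ags}(h)$; $K_\alpha\phi$ iff $\phi$ holds at every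 situation $\sim_\alpha$-related to $\langle m,h\rangle$. -}

module Defs where

open import Level using (Level)
open import Data.Nat using (ℕ)
open import Data.Fin using (Fin)
open import Data.Empty using (⊥)
open import Data.Sum using (_⊎_)
open import Data.Product using (_×_; Σ; ∃)
open import Relation.Binary.PropositionalEquality using (_≡_)

record BT : Set₁ where
  field
    T       : Set
    _⊏_     : T → T → Set
    inhabited : T
    ⊏-irrefl : ∀ {m} → m ⊏ m → ⊥
    ⊏-trans  : ∀ {a b c} → a ⊏ b → b ⊏ c → a ⊏ c
    no-backward-branching :
      ∀ {a b m} → a ⊏ m → b ⊏ m → (a ⊏ b) ⊎ (a ≡ b) ⊎ (b ⊏ a)

  _⊑_ : T → T → Set
  a ⊑ b = (a ⊏ b) ⊎ (a ≡ b)

  IsChain : (T → Set) → Set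
  IsChain C = ∀ a b → C a → C b → (a ⊏ b) ⊎ (a ≡ b) ⊎ (b ⊏ a)

  record History : Set₁ where
    field
      mem      : T → Set
      chain    : IsChain mem
      maximal  : ∀ (C : T → Set) → IsChain C →
                 (∀ a → mem a → C a) → ∀ a → C a → mem a

  _∈_ : T → History → Set
  m ∈ h = History.mem h m

  record Situation : Set₁ where
    constructor ⟨_,_⟩[_]
    field
      mom  : T
      hist : History
      .inh : mom ∈ hist



record EBDT (n : ℕ) (B : BT) : Set₁ where
  open BT B using (T; _⊏_; _⊑_; History; _∈_; Situation; ⟨_,_⟩[_])
  field
    next       : (m : T) (h : History) → .(m ∈ h) → T
    next-in    : ∀ m h .(p : m ∈ h) → next m h p ∈ h
    next-after : ∀ m h .(p : m ∈ h) → m ⊏ next m h p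
    next-least : ∀ m h .(p : m ∈ h) → ∀ m' → m' ∈ h → m ⊏ m' → next m h p ⊑ m'
    prev       : (m : T) (h : History) → .(m ∈ h) → T
    prev-in    : ∀ m h .(p : m ∈ h) → prev m h p ∈ h
    prev-before : ∀ m h .(p : m ∈ h) → prev m h p ⊏ m
    prev-greatest : ∀ m h .(p : m ∈ h) → ∀ m' → m' ∈ h → m' ⊏ m → m' ⊑ prev m h p

    -- Choice^m_α as a partition of H_m, given by its equivalence relation
    -- (Choice α m h h' : h' lies in the cell Choice^m_α(h))
    Choice       : Fin n → T → History → History → Set
    Choice-refl  : ∀ α m h → m ∈ h → Choice α m h h
    Choice-sym   : ∀ α m h h' → m ∈ h → m ∈ h' → Choice α m h h' → Choice α m h' h
    Choice-trans : ∀ α m h h' h'' → m ∈ h → m ∈ h' → m ∈ h'' →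
                   Choice α m h h' → Choice α m h' h'' → Choice α m h h''
    no-choice-undivided : ∀ α m h h' → m ∈ h → m ∈ h' →
                   (∃ λ m' → m ⊏ m' × m' ∈ h × m' ∈ h') → Choice α m h h'
    -- independence of agency: any selection of one cell per agent
    -- (each given by a representative history in H_m) has nonempty intersection
    independence : ∀ m (s : Fin n → History) → (∀ α → m ∈ s α) →
                   Σ History λ h → m ∈ h × (∀ α → Choice α m (s α) h)

    _∼[_]_   : Situation → Fin n → Situation → Set
    ∼-refl  : ∀ α s → s ∼[ α ] s
    ∼-sym   : ∀ α s s' → s ∼[ α ] s' → s' ∼[ α ] s
    ∼-trans : ∀ α s s' s'' → s ∼[ α ] s' → s' ∼[ α ] s'' → s ∼[ α ] s''
    no-forgetting : ∀ α m h .(p : m ∈ h) (m* : T) (h* : History) .(p* : m* ∈ h*) →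
      ⟨ next m h p , h ⟩[ next-in m h p ] ∼[ α ] ⟨ m* , h* ⟩[ p* ] →
      ⟨ m , h ⟩[ p ] ∼[ α ] ⟨ prev m* h* p* , h* ⟩[ prev-in m* h* p* ]

  ChoiceAgs : T → History → History → Set
  ChoiceAgs m h h' = ∀ α → Choice α m h h'

data Form (n : ℕ) : Set where
  atom  : ℕ → Form n
  ¬'_   : Form n → Form n
  _∧'_  : Form n → Form n → Form n
  □_    : Form n → Form n
  X_    : Form n → Form n
  Y_    : Form n → Form n
  [_]_  : Fin n → Form n → Form n
  [Ags]_ : Form n → Form n
  K[_]_ : Fin n → Form n → Form n

infixr 6 _⇒_
_⇒_ : ∀ {n} → Form n → Form n → Form n
φ ⇒ ψ = ¬' (φ ∧' (¬' ψ))

Valuation : BT → Set₁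
Valuation B = ℕ → BT.T B → BT.History B → Set

module _ {n : ℕ} {B : BT} (F : EBDT n B) (V : Valuation B) where
  open BT B using (T; History; _∈_; Situation; ⟨_,_⟩[_])
  open EBDT F

  _⊨_ : Situation → Form n → Set₁
  ⟨ m , h ⟩[ p ] ⊨ atom q = Level.Lift _ (V q m h)
  s ⊨ (¬' φ) = s ⊨ φ → ⊥
  s ⊨ (φ ∧' ψ) = (s ⊨ φ) × (s ⊨ ψ)
  ⟨ m , h ⟩[ p ] ⊨ (□ φ) = ∀ h' → .(p' : m ∈ h') → ⟨ m , h' ⟩[ p' ] ⊨ φ
  ⟨ m , h ⟩[ p ] ⊨ (X φ) = ⟨ next m h p , h ⟩[ next-in m h p ] ⊨ φ
  ⟨ m , h ⟩[ p ] ⊨ (Y φ) = ⟨ prev m h p , h ⟩[ prev-in m h p ] ⊨ φ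
  ⟨ m , h ⟩[ p ] ⊨ ([ α ] φ) =
    ∀ h' → .(p' : m ∈ h') → Choice α m h h' → ⟨ m , h' ⟩[ p' ] ⊨ φ
  ⟨ m , h ⟩[ p ] ⊨ ([Ags] φ) =
    ∀ h' → .(p' : m ∈ h') → ChoiceAgs m h h' → ⟨ m , h' ⟩[ p' ] ⊨ φ
  s ⊨ (K[ α ] φ) = ∀ s' → s ∼[ α ] s' → s' ⊨ φ

ValidOn : ∀ {n} {B : BT} → EBDT n B → Form n → Set₁
ValidOn {n} {B} F φ = ∀ (V : Valuation B) (s : BT.Situation B) → _⊨_ F V s φ

module Submission where

open import Defs
open import Data.Nat using (ℕ)
open import Data.Fin using (Fin)
open import Data.Product using (_×_; _,_)
open import Function using (_∘′_)

-- Both formulas are chains of frame-valid entailments.  The first: □ is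
-- reflexive and [α] quantifies over fewer histories than □, and K[α] is
-- monotone.  The second: [Ags] quantifies over fewer histories than [α], and
-- no forgetting turns K[α]ψ at ⟨m, h⟩ into K[α]Yψ at ⟨m⁺ʰ, h⟩.

module _ {n : ℕ} {B : BT} (F : EBDT n B) where
  open BT B using (⟨_,_⟩[_])
  open EBDT F

  -- A record rather than a function type, so that the formulas can be
  -- inferred from an entailment.
  record Entails (φ ψ : Form n) : Set₁ where
    constructor entails
    field
      holds : ∀ V s → _⊨_ F V s φ → _⊨_ F V s ψ
  open Entails

  Entails-trans : ∀ {φ ψ χ} → Entails φ ψ → Entails ψ χ → Entails φ χ
  Entails-trans φ⊢ψ ψ⊢χ = entails λ V s → holds ψ⊢χ V s ∘′ holds φ⊢ψ V s

  Entails⇒valid : ∀ {φ ψ} → Entails φ ψ → ValidOn F (φ ⇒ ψ)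
  Entails⇒valid φ⊢ψ V s (sφ , s¬ψ) = s¬ψ (holds φ⊢ψ V s sφ)

  □-elim : ∀ {φ} → Entails (□ φ) φ
  □-elim = entails λ { V ⟨ m , h ⟩[ p ] □φ → □φ h p }

  □⇒[α] : ∀ {φ α} → Entails (□ φ) ([ α ] φ)
  □⇒[α] = entails λ { V ⟨ m , h ⟩[ p ] □φ h′ p′ _ → □φ h′ p′ }

  [α]⇒[Ags] : ∀ {φ α} → Entails ([ α ] φ) ([Ags] φ)
  [α]⇒[Ags] {α = α} = entails λ { V ⟨ m , h ⟩[ p ] αφ h′ p′ c → αφ h′ p′ (c α) }

  K-mono : ∀ {φ ψ α} → Entails φ ψ → Entails (K[ α ] φ) (K[ α ] ψ)
  K-mono φ⊢ψ = entails λ V s Kφ s′ s∼s′ → holds φ⊢ψ V s′ (Kφ s′ s∼s′)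

  K⇒XKY : ∀ {φ α} → Entails (K[ α ] φ) (X (K[ α ] (Y φ)))
  K⇒XKY {α = α} = entails λ
    { V ⟨ m , h ⟩[ p ] Kφ ⟨ m* , h* ⟩[ p* ] next∼s* →
        Kφ _ (no-forgetting α m h p m* h* p* next∼s*) }

proposition1 : ∀ {n : ℕ} (B : BT) (F : EBDT n B) (φ : Form n) (α : Fin n) →
    ValidOn F ((□ (K[ α ] (□ (X φ)))) ⇒ (K[ α ] ([ α ] (X φ))))
    × ValidOn F ((K[ α ] ([ α ] (X φ))) ⇒ (X (K[ α ] (Y ([Ags] (X φ))))))
proposition1 B F φ α = Entails⇒valid F □K□X⊢K[α]X , Entails⇒valid F K[α]X⊢XKY[Ags]X
  where
    □K□X⊢K[α]X : Entails F (□ (K[ α ] (□ (X φ)))) (K[ α ] ([ α ] (X φ)))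
    □K□X⊢K[α]X = Entails-trans F (□-elim F) (K-mono F (□⇒[α] F))

    K[α]X⊢XKY[Ags]X : Entails F (K[ α ] ([ α ] (X φ))) (X (K[ α ] (Y ([Ags] (X φ)))))
    K[α]X⊢XKY[Ags]X = Entails-trans F (K-mono F ([α]⇒[Ags] F)) (K⇒XKY F)
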